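{- Let $G$ be a connected graph of order $n$. Then for any graph $H$ having a connected component isomorphic to a complete graph and satisfying $n>2c(H)+1\ge 5$, we have $pd(G\odot H)\ge c(H)+2$.
   Context: For a graph $H$ which has a connected component isomorphic to a complete graph, $c(H)$ denotes the maximum cardinality of a connected component of $H$ that is isomorphic to a complete graph. For a connected graph $F$ and an ordered partition $\Pi=\{P_1,\dots,P_t\}$ of $V(F)$, $r(v|\Pi)=(d(v,P_1),\dots,d(v,P_t))$ where $d$ is shortest-path distance and $d(v,P_i)=\min_{u\in P_i}d(v,u)$; $\Pi$ is a resolving partition if $r(u|\Pi)\ne r(v|\Pi)$ for all distinct vertices $u,v$; $pd(F)$ is the minimum number of sets in a resolving partition. For graphs $G$ of order $n_1$ (vertices $v_1,\dots,v_{n_1}$) and $H$, the corona product $G\odot H$ is obtained from one copy of $G$ and $n_1$ copies $H_1,\dots,H_{n_1}$ of $H$ by joining $v_i$ to every vertex of $H_i$. -}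

module Defs where

open import Data.Nat using (ℕ; zero; suc; _≤_)
open import Data.Fin using (Fin)
open import Data.Fin.Subset using (Subset; _∈_; ∣_∣)
open import Data.Product using (Σ; ∃; ∃-syntax; _×_; _,_)
open import Data.Sum using (_⊎_; inj₁; inj₂)
open import Data.Empty using (⊥)
open import Relation.Nullary using (¬_)
open import Relation.Binary.PropositionalEquality using (_≡_; _≢_; refl; sym)

record Graph (V : Set) : Set₁ where
  field
    Adj        : V → V → Set
    Adj-sym    : ∀ {u v} → Adj u v → Adj v u
    Adj-irrefl : ∀ {v} → ¬ Adj v v
open Graph public

data Walk {V : Set} (G : Graph V) : V → V → ℕ → Set where
  nil  : ∀ {v} → Walk G v v zero
  cons : ∀ {u w v k} → Adj G u w → Walk G w v k → Walk G u v (suc k)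

Connected : {V : Set} → Graph V → Set
Connected G = ∀ u v → ∃[ k ] Walk G u v k

DistToSet : {V : Set} → Graph V → V → (V → Set) → ℕ → Set
DistToSet G v P k =
  (∃[ u ] (P u × Walk G v u k)) × (∀ u j → P u → Walk G v u j → k ≤ j)

-- An ordered partition {P_1,...,P_t} of V: class assignment V → Fin t
-- with every class nonempty. P_i = { v | f v ≡ i }.
IsOrderedPartition : (V : Set) (t : ℕ) → (V → Fin t) → Set
IsOrderedPartition V t f = ∀ i → ∃[ v ] f v ≡ i

Class : {V : Set} {t : ℕ} → (V → Fin t) → Fin t → V → Set
Class f i v = f v ≡ i

Resolving : {V : Set} {t : ℕ} → Graph V → (V → Fin t) → Set
Resolving {V} {t} G f =
  ∀ u v → u ≢ v → ∃[ i ] ∃[ a ] ∃[ b ]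
    (DistToSet G u (Class f i) a × DistToSet G v (Class f i) b × a ≢ b)

IsPartitionDimension : {V : Set} → Graph V → ℕ → Set
IsPartitionDimension {V} F p =
  (Σ (V → Fin p) λ f → IsOrderedPartition V p f × Resolving F f)
  × (∀ t (f : V → Fin t) → IsOrderedPartition V t f → Resolving F f → p ≤ t)

-- Corona product G ⊙ H: vertices inj₁ i (the copy of G) and inj₂ (i , x)
-- (vertex x of the i-th copy H_i of H).
coronaAdj : {n m : ℕ} → Graph (Fin n) → Graph (Fin m) →
            Fin n ⊎ (Fin n × Fin m) → Fin n ⊎ (Fin n × Fin m) → Set
coronaAdj G H (inj₁ a) (inj₁ b) = Adj G a b
coronaAdj G H (inj₁ a) (inj₂ (i , x)) = a ≡ i
coronaAdj G H (inj₂ (i , x)) (inj₁ a) = i ≡ a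
coronaAdj G H (inj₂ (i , x)) (inj₂ (j , y)) = i ≡ j × Adj H x y

coronaAdj-sym : {n m : ℕ} (G : Graph (Fin n)) (H : Graph (Fin m)) →
  ∀ {u v} → coronaAdj G H u v → coronaAdj G H v u
coronaAdj-sym G H {inj₁ a} {inj₁ b} e = Adj-sym G e
coronaAdj-sym G H {inj₁ a} {inj₂ _} e = sym e
coronaAdj-sym G H {inj₂ _} {inj₁ a} e = sym e
coronaAdj-sym G H {inj₂ _} {inj₂ _} (p , e) = sym p , Adj-sym H e

coronaAdj-irrefl : {n m : ℕ} (G : Graph (Fin n)) (H : Graph (Fin m)) →
  ∀ {v} → ¬ coronaAdj G H v v
coronaAdj-irrefl G H {inj₁ a} e = Adj-irrefl G e
coronaAdj-irrefl G H {inj₂ _} (_ , e) = Adj-irrefl H e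

corona : {n m : ℕ} → Graph (Fin n) → Graph (Fin m) → Graph (Fin n ⊎ (Fin n × Fin m))
corona G H = record
  { Adj = coronaAdj G H
  ; Adj-sym = λ {u} {v} → coronaAdj-sym G H {u} {v}
  ; Adj-irrefl = λ {v} → coronaAdj-irrefl G H {v} }

-- S is the vertex set of a connected component of H isomorphic to a
-- complete graph: nonempty, pairwise adjacent, and closed under adjacency.
IsCompleteComponent : {m : ℕ} → Graph (Fin m) → Subset m → Set
IsCompleteComponent H S =
  (∃[ x ] x ∈ S)
  × (∀ x y → x ∈ S → y ∈ S → x ≢ y → Adj H x y)
  × (∀ x y → x ∈ S → Adj H x y → y ∈ S)

IsC : {m : ℕ} → Graph (Fin m) → ℕ → Set
IsC {m} H c =
  (∃[ S ] (IsCompleteComponent H S × ∣ S ∣ ≡ c))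
  × (∀ S → IsCompleteComponent H S → ∣ S ∣ ≤ c)

module Submission where

-- Let S be a complete component of H with |S| = c ≥ 2, and suppose, for a
-- contradiction, that f is a resolving partition of G ⊙ H into p ≤ c + 1
-- classes.  Write v_i for the i-th vertex of G and S_i for the copy of S
-- inside H_i.
--   * Two vertices of S_i are twins, so they lie in different classes; hence
--     S_i uses c distinct classes and misses at most one class.
--   * Either every class missed by S_i is the class of v_i ("saturated"), or
--     S_i misses exactly one class m ≠ f(v_i).  This labels each root by one of
--     p + 1 values, and n > 2c + 1 ≥ p + 1 forces two roots with equal label.
--   * Two saturated roots, or two roots missing the same class m, always
--     produce two vertices with the same distance to every class, which is
--     impossible for a resolving partition.

open import Defs
open import Data.Nat using (ℕ; _+_; _*_; _≤_; _<_)
open import Data.Fin using (Fin)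

open import Data.Nat using (zero; suc; z≤n; s≤s; _≤?_)
import Data.Nat.Properties as ℕP
open import Data.Nat.Induction using (<-rec)
open import Data.Fin using (zero; suc; punchOut; fromℕ; inject₁; _≟_)
import Data.Fin.Properties as FinP
open import Data.Fin.Subset using (Subset; _∈_; ∣_∣; inside; outside)
open import Data.Fin.Subset.Properties using (_∈?_)
open import Data.Vec using ([]; _∷_; here; there)
open import Data.Product using (∃; ∃₂; _×_; _,_)
open import Relation.Nullary.Decidable using (_×-dec_)
open import Data.Sum using (_⊎_; inj₁; inj₂)
open import Data.Empty using (⊥; ⊥-elim)
open import Data.Unit using (⊤; tt)
open import Function using (_∘_)
open import Function.Definitions using (Injective)
open import Relation.Nullary using (¬_; Dec; yes; no; ¬?)
open import Relation.Binary.Definitions using (tri<; tri≈; tri>)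
open import Relation.Binary.PropositionalEquality
  using (_≡_; _≢_; refl; sym; trans; cong; subst)

record Enumeration {m : ℕ} (S : Subset m) : Set where
  field
    element   : Fin ∣ S ∣ → Fin m
    member    : ∀ k → element k ∈ S
    injective : Injective _≡_ _≡_ element

enumerate : ∀ {m} (S : Subset m) → Enumeration S
enumerate [] = record { element = λ () ; member = λ () ; injective = λ { {()} } }
enumerate (outside ∷ S) = record
  { element   = suc ∘ element
  ; member    = there ∘ member
  ; injective = injective ∘ FinP.suc-injective }
  where open Enumeration (enumerate S)
enumerate {suc m} (inside ∷ S) = record
  { element = element′ ; member = member′ ; injective = injective′ }
  where
  open Enumeration (enumerate S)
  element′ : Fin (suc ∣ S ∣) → Fin (suc m)
  element′ zero    = zero
  element′ (suc k) = suc (element k)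
  member′ : ∀ k → element′ k ∈ (inside ∷ S)
  member′ zero    = here
  member′ (suc k) = there (member k)
  injective′ : Injective _≡_ _≡_ element′
  injective′ {zero}  {zero}  _  = refl
  injective′ {suc k} {suc l} eq = cong suc (injective (FinP.suc-injective eq))

two-elements : ∀ {m} (S : Subset m) → 2 ≤ ∣ S ∣ →
               ∃₂ λ x y → x ∈ S × y ∈ S × x ≢ y
two-elements S two≤|S| with distinct-indices two≤|S|
  where
  distinct-indices : ∀ {t} → 2 ≤ t → ∃₂ λ (k l : Fin t) → k ≢ l
  distinct-indices (s≤s (s≤s _)) = zero , suc zero , λ ()
... | k , l , k≢l = element k , element l , member k , member l , k≢l ∘ injective
  where open Enumeration (enumerate S)

injection-missing-one : ∀ {c t} (g : Fin c → Fin t) → Injective _≡_ _≡_ g →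
                        ∀ a → (∀ k → a ≢ g k) → suc c ≤ t
injection-missing-one {t = suc t} g g-inj a misses =
  s≤s (FinP.injective⇒≤ λ eq → g-inj (FinP.punchOut-injective (misses _) (misses _) eq))

injection-missing-two : ∀ {c t} (g : Fin c → Fin t) → Injective _≡_ _≡_ g →
                        ∀ {a b} → a ≢ b → (∀ k → a ≢ g k) → (∀ k → b ≢ g k) → 2 + c ≤ t
injection-missing-two {c} {suc t} g g-inj {a} {b} a≢b misses-a misses-b =
  s≤s (injection-missing-one squeezed squeezed-inj (punchOut a≢b) squeezed-misses)
  where
  squeezed : Fin c → Fin t
  squeezed k = punchOut (misses-a k)
  squeezed-inj : Injective _≡_ _≡_ squeezed
  squeezed-inj eq = g-inj (FinP.punchOut-injective (misses-a _) (misses-a _) eq)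
  squeezed-misses : ∀ k → punchOut a≢b ≢ squeezed k
  squeezed-misses k eq = misses-b k (FinP.punchOut-injective a≢b (misses-a k) eq)

LeastWitness : (ℕ → Set) → Set
LeastWitness Q = ∃ λ d → Q d × (∀ j → Q j → d ≤ j)

least-witness : (Q : ℕ → Set) → ∀ {k} → Q k → ¬ ¬ LeastWitness Q
least-witness Q {k} = <-rec (λ k → Q k → ¬ ¬ LeastWitness Q) step k
  where
  step : ∀ k → (∀ {j} → j < k → Q j → ¬ ¬ LeastWitness Q) → Q k → ¬ ¬ LeastWitness Q
  step k smaller Qk no-least = no-least (k , Qk , below)
    where
    below : ∀ j → Q j → k ≤ j
    below j Qj with k ≤? j
    ... | yes k≤j = k≤j
    ... | no k≰j  = ⊥-elim (smaller (ℕP.≰⇒> k≰j) Qj no-least)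

module ClassDistances {V : Set} (F : Graph V) {t : ℕ} (f : V → Fin t) where

  Dist : V → Fin t → ℕ → Set
  Dist u q = DistToSet F u (Class f q)

  dist-unique : ∀ {u q a b} → Dist u q a → Dist u q b → a ≡ b
  dist-unique ((w , fw , W) , least) ((w′ , fw′ , W′) , least′) =
    ℕP.≤-antisym (least w′ _ fw′ W′) (least′ w _ fw W)

  dist-own : ∀ {u q} → f u ≡ q → Dist u q 0
  dist-own {u} fu = (u , fu , nil) , λ _ _ _ _ → z≤n

  dist-zero : ∀ {u q} → Dist u q 0 → f u ≡ q
  dist-zero ((_ , fu , nil) , _) = fu

  dist-neighbour : ∀ {u w q} → Adj F u w → f w ≡ q → f u ≢ q → Dist u q 1
  dist-neighbour {u} {w} {q} adj fw fu≢q = (w , fw , cons adj nil) , positive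
    where
    positive : ∀ w′ j → f w′ ≡ q → Walk F u w′ j → 1 ≤ j
    positive _ .zero fu nil = ⊥-elim (fu≢q fu)
    positive _ _ _ (cons _ _) = s≤s z≤n

  dist-≤1 : ∀ {u w q d} → Adj F u w → f w ≡ q → Dist u q d → d ≤ 1
  dist-≤1 adj fw (_ , least) = least _ 1 fw (cons adj nil)

  dist-exists : ∀ {u} → (∀ w → ∃ λ k → Walk F u w k) →
                IsOrderedPartition V t f → ∀ q → ¬ ¬ ∃ (Dist u q)
  dist-exists {u} reach partition q no-dist with partition q
  ... | w , fw with reach w
  ... | k , W = least-witness Reaches (w , fw , W) λ where
      (d , reaches , least) → no-dist (d , reaches , λ w′ j fw′ W′ → least j (w′ , fw′ , W′))
    where
    Reaches : ℕ → Set
    Reaches k = ∃ λ w → Class f q w × Walk F u w k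

  resolving-separates : Resolving F f → ∀ {u v} → u ≢ v → f u ≡ f v →
    (∀ q → f u ≢ q → ¬ ¬ ∃ λ d → Dist u q d × Dist v q d) → ⊥
  resolving-separates resolving {u} {v} u≢v same-class same-dist
    with resolving u v u≢v
  ... | q , a , b , da , db , a≢b with f u ≟ q
  ...   | yes fu = a≢b (trans (dist-unique da (dist-own fu))
                              (dist-unique (dist-own (trans (sym same-class) fu)) db))
  ...   | no fu≢q = same-dist q fu≢q λ where
          (d , du , dv) → a≢b (trans (dist-unique da du) (dist-unique dv db))

Vertex : ℕ → ℕ → Set
Vertex n m = Fin n ⊎ (Fin n × Fin m)

pattern root i   = inj₁ i
pattern leaf i x = inj₂ (i , x)

module CoronaWalks {n m : ℕ} (G : Graph (Fin n)) (H : Graph (Fin m)) where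

  Γ : Graph (Vertex n m)
  Γ = corona G H

  lift : ∀ {a b k} → Walk G a b k → Walk Γ (root a) (root b) k
  lift nil        = nil
  lift (cons e W) = cons e (lift W)

  snoc : ∀ {u v w k} → Walk Γ u v k → Adj Γ v w → Walk Γ u w (suc k)
  snoc nil         e = cons e nil
  snoc (cons e′ W) e = cons e′ (snoc W e)

  reachable : Connected G → ∀ a w → ∃ λ k → Walk Γ (root a) w k
  reachable connected a (root b) with connected a b
  ... | k , W = k , lift W
  reachable connected a (leaf b y) with connected a b
  ... | k , W = suc k , snoc (lift W) refl

  -- A walk starting in an H-closed part T of the copy H_i and ending outside
  -- it passes through v_i, so v_i has a strictly shorter walk to its end.
  leave-via-root : (T : Fin m → Set) → (∀ x y → T x → Adj H x y → T y) →
    ∀ {i x w k} → T x → Walk Γ (leaf i x) w k → (∀ z → T z → w ≢ leaf i z) →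
    ∃ λ k′ → Walk Γ (root i) w k′ × k′ < k
  leave-via-root T closed Tx nil exits = ⊥-elim (exits _ Tx refl)
  leave-via-root T closed Tx (cons {w = root a} refl W) exits = _ , W , ℕP.≤-refl
  leave-via-root T closed Tx (cons {w = leaf j z} (refl , adj) W) exits
    with leave-via-root T closed (closed _ z Tx adj) W exits
  ... | k′ , W′ , k′<k = k′ , W′ , ℕP.m≤n⇒m≤1+n k′<k

module CoronaDistances {n m : ℕ} (G : Graph (Fin n)) (H : Graph (Fin m))
  (S : Subset m)
  (complete : ∀ x y → x ∈ S → y ∈ S → x ≢ y → Adj H x y)
  (closed : ∀ x y → x ∈ S → Adj H x y → y ∈ S)
  {p : ℕ} (f : Vertex n m → Fin p) where

  open CoronaWalks G H public
  open ClassDistances Γ f public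

  Covers : Fin n → Fin p → Set
  Covers i q = ∃ λ x → x ∈ S × f (leaf i x) ≡ q

  covers? : ∀ i q → Dec (Covers i q)
  covers? i q = FinP.any? λ x → (x ∈? S) ×-dec (f (leaf i x) ≟ q)

  -- S_i is a clique, so a vertex of S_i sees every class used by S_i.
  leaf-dist-covered : ∀ {i x q} → x ∈ S → Covers i q → f (leaf i x) ≢ q →
                      Dist (leaf i x) q 1
  leaf-dist-covered {x = x} x∈S (y , y∈S , fy) fx≢q =
    dist-neighbour (refl , complete x y x∈S y∈S x≢y) fy fx≢q
    where
    x≢y : x ≢ y
    x≢y refl = fx≢q fy

  -- v_i is adjacent to all of S_i.
  root-dist-covered : ∀ {i q} → Covers i q → f (root i) ≢ q → Dist (root i) q 1
  root-dist-covered (_ , _ , fy) = dist-neighbour refl fy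

  root-dist-≤1 : ∀ {i q d} → Covers i q → Dist (root i) q d → d ≤ 1
  root-dist-≤1 (_ , _ , fy) = dist-≤1 refl fy

  -- If S_i misses q, a vertex of S_i reaches P_q only through v_i.
  leaf-dist-uncovered : ∀ {i x q e} → x ∈ S → ¬ Covers i q → Dist (root i) q e →
                        Dist (leaf i x) q (suc e)
  leaf-dist-uncovered {i} {x} {q} {e} x∈S uncovered ((w , fw , W) , least) =
    (w , fw , cons refl W) , longer
    where
    longer : ∀ w′ j → f w′ ≡ q → Walk Γ (leaf i x) w′ j → suc e ≤ j
    longer w′ j fw′ W′ with leave-via-root (_∈ S) closed x∈S W′
                              (λ { z z∈S refl → uncovered (z , z∈S , fw′) })
    ... | k′ , W″ , k′<j = ℕP.≤-trans (s≤s (least w′ k′ fw′ W″)) k′<j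

  -- A root at distance ≥ 2 from P_q has a G-neighbour one step closer:
  -- a shortest walk cannot start by entering the root's own copy of H.
  root-descent : ∀ {i q e} → Dist (root i) q (suc (suc e)) →
                 ∃ λ a → Dist (root a) q (suc e)
  root-descent ((w , fw , cons {w = root a} adj W) , least) =
    a , (w , fw , W) , λ w′ j fw′ W′ → ℕP.≤-pred (least w′ (suc j) fw′ (cons adj W′))
  root-descent {i} {q} {e} ((w , fw , cons {w = leaf _ z} refl W) , least) = ⊥-elim (escape w fw W)
    where
    -- leaving H_i again goes through v_i, giving a walk shorter than e + 2
    shortcut : ∀ {w} → f w ≡ q → Walk Γ (leaf i z) w (suc e) → (∀ y → w ≢ leaf i y) → ⊥
    shortcut fw W exits with leave-via-root (λ _ → ⊤) (λ _ _ _ _ → tt) tt W (λ y _ → exits y)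
    ... | k′ , W′ , k′<1+e = ℕP.<⇒≱ (ℕP.m<n⇒m<1+n k′<1+e) (least _ k′ fw W′)
    -- staying in H_i ends at a neighbour of v_i, at distance 1 < e + 2
    escape : ∀ w → f w ≡ q → Walk Γ (leaf i z) w (suc e) → ⊥
    escape (root b) fw W = shortcut fw W λ _ ()
    escape (leaf j y) fw W with i ≟ j
    ... | yes refl = ℕP.<⇒≱ (s≤s (s≤s z≤n)) (least _ 1 fw (cons refl nil))
    ... | no i≢j   = shortcut fw W λ { _ refl → i≢j refl }

  root-dist-exists : Connected G → IsOrderedPartition (Vertex n m) p f →
                     ∀ i q → ¬ ¬ ∃ (Dist (root i) q)
  root-dist-exists connected partition i = dist-exists (reachable connected i) partition

module LowerBound {n m : ℕ} (G : Graph (Fin n)) (connected : Connected G)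
  (H : Graph (Fin m)) (S : Subset m)
  (complete : ∀ x y → x ∈ S → y ∈ S → x ≢ y → Adj H x y)
  (closed : ∀ x y → x ∈ S → Adj H x y → y ∈ S)
  {p : ℕ} (f : Vertex n m → Fin p)
  (partition : IsOrderedPartition (Vertex n m) p f)
  (resolving : Resolving (corona G H) f)
  (few-classes : p < ∣ S ∣ + 2) (S-large : 2 ≤ ∣ S ∣) (many-roots : suc p < n) where

  open CoronaDistances G H S complete closed f

  root-dist : ∀ i q → ¬ ¬ ∃ (Dist (root i) q)
  root-dist = root-dist-exists connected partition

  separates : ∀ {u v} → u ≢ v → f u ≡ f v →
    (∀ q → f u ≢ q → ¬ ¬ ∃ λ d → Dist u q d × Dist v q d) → ⊥
  separates = resolving-separates resolving

  -- Vertices of S_i are twins, so they get pairwise distinct classes.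
  twins-separated : ∀ {i x y} → x ∈ S → y ∈ S → x ≢ y → f (leaf i x) ≢ f (leaf i y)
  twins-separated {i} {x} {y} x∈S y∈S x≢y same = separates (λ { refl → x≢y refl }) same equal
    where
    equal : ∀ q → f (leaf i x) ≢ q → ¬ ¬ ∃ λ d → Dist (leaf i x) q d × Dist (leaf i y) q d
    equal q fx≢q with covers? i q
    ... | yes cov = λ k → k (1 , leaf-dist-covered x∈S cov fx≢q
                                , leaf-dist-covered y∈S cov (fx≢q ∘ trans same))
    ... | no uncov = λ k → root-dist i q λ where
      (e , de) → k (suc e , leaf-dist-uncovered x∈S uncov de , leaf-dist-uncovered y∈S uncov de)

  -- S_i uses |S| distinct classes among p ≤ |S| + 1, so it misses at most one.
  unique-missing : ∀ {i a b} → ¬ Covers i a → ¬ Covers i b → a ≡ b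
  unique-missing {i} {a} {b} uncov-a uncov-b with a ≟ b
  ... | yes a≡b = a≡b
  ... | no a≢b  = ⊥-elim (ℕP.<⇒≱ few-classes (subst (_≤ p) (ℕP.+-comm 2 ∣ S ∣)
          (injection-missing-two class-of class-of-injective a≢b
             (λ k eq → uncov-a (element k , member k , sym eq))
             (λ k eq → uncov-b (element k , member k , sym eq)))))
    where
    open Enumeration (enumerate S)
    class-of : Fin ∣ S ∣ → Fin p
    class-of k = f (leaf i (element k))
    class-of-injective : Injective _≡_ _≡_ class-of
    class-of-injective {k} {l} same with element k ≟ element l
    ... | yes eq = injective eq
    ... | no ne  = ⊥-elim (twins-separated (member k) (member l) ne same)

  covered-except : ∀ {i m q} → ¬ Covers i m → q ≢ m → Covers i q
  covered-except {i} {q = q} uncov-m q≢m with covers? i q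
  ... | yes cov   = cov
  ... | no uncov = ⊥-elim (q≢m (unique-missing uncov uncov-m))

  Saturated : Fin n → Set
  Saturated i = ∀ q → ¬ Covers i q → f (root i) ≡ q

  MissesOther : Fin n → Fin p → Set
  MissesOther i m = ¬ Covers i m × f (root i) ≢ m

  Kind : Fin n → Set
  Kind i = Saturated i ⊎ ∃ (MissesOther i)

  classify : ∀ i → Kind i
  classify i with FinP.any? (λ q → ¬? (covers? i q))
  ... | no all-covered = inj₁ λ q uncov → ⊥-elim (all-covered (q , uncov))
  ... | yes (m , uncov-m) with f (root i) ≟ m
  ...   | no fi≢m = inj₂ (m , uncov-m , fi≢m)
  ...   | yes fi≡m = inj₁ λ q uncov → trans fi≡m (unique-missing uncov-m uncov)

  label : ∀ {i} → Kind i → Fin (suc p)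
  label (inj₁ _)       = fromℕ p
  label (inj₂ (m , _)) = inject₁ m

  saturated-leaf-dist : ∀ {i x q} → Saturated i → x ∈ S → f (leaf i x) ≢ q →
                        Dist (leaf i x) q 1
  saturated-leaf-dist {i} {q = q} saturated x∈S fx≢q with covers? i q
  ... | yes cov   = leaf-dist-covered x∈S cov fx≢q
  ... | no uncov = leaf-dist-uncovered x∈S uncov (dist-own (saturated q uncov))

  saturated-leaves-collide : ∀ {i i′ x y} → i ≢ i′ → Saturated i → Saturated i′ →
    x ∈ S → y ∈ S → f (leaf i x) ≡ f (leaf i′ y) → ⊥
  saturated-leaves-collide i≢i′ sat sat′ x∈S y∈S same =
    separates (λ { refl → i≢i′ refl }) same λ q fx≢q k →
      k (1 , saturated-leaf-dist sat x∈S fx≢q , saturated-leaf-dist sat′ y∈S (fx≢q ∘ trans same))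

  -- Two saturated roots: S_i′ covers one of two classes used by S_i, giving
  -- a collision, unless it misses both, which is impossible.
  two-saturated : ∀ {i i′} → i ≢ i′ → Saturated i → Saturated i′ → ⊥
  two-saturated {i} {i′} i≢i′ sat sat′ with two-elements S S-large
  ... | x , y , x∈S , y∈S , x≢y with covers? i′ (f (leaf i x)) | covers? i′ (f (leaf i y))
  ...   | yes (z , z∈S , fz) | _ = saturated-leaves-collide i≢i′ sat sat′ x∈S z∈S (sym fz)
  ...   | no _ | yes (z , z∈S , fz) = saturated-leaves-collide i≢i′ sat sat′ y∈S z∈S (sym fz)
  ...   | no uncov-x | no uncov-y = twins-separated x∈S y∈S x≢y (unique-missing uncov-x uncov-y)

  -- Roots missing the same class m at equal distance from P_m: a vertex of
  -- S_i and one of S_i′ in the same class collide.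
  equidistant-roots : ∀ {i i′ m D} → i ≢ i′ → MissesOther i m → MissesOther i′ m →
    Dist (root i) m D → Dist (root i′) m D → ⊥
  equidistant-roots {i} {i′} {m} i≢i′ (uncov , _) (uncov′ , _) di di′
    with two-elements S S-large
  ... | x , _ , x∈S , _ with covered-except uncov′ (λ fx≡m → uncov (x , x∈S , fx≡m))
  ...   | y , y∈S , fy = separates (λ { refl → i≢i′ refl }) (sym fy) equal
    where
    equal : ∀ q → f (leaf i x) ≢ q → ¬ ¬ ∃ λ d → Dist (leaf i x) q d × Dist (leaf i′ y) q d
    equal q fx≢q k with q ≟ m
    ... | yes refl = k (_ , leaf-dist-uncovered x∈S uncov di , leaf-dist-uncovered y∈S uncov′ di′)
    ... | no q≢m = k (1 , leaf-dist-covered x∈S (covered-except uncov q≢m) fx≢q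
                        , leaf-dist-covered y∈S (covered-except uncov′ q≢m) (fx≢q ∘ trans (sym fy)))

  -- A root v_i one step farther from P_m than a root v_j whose copy misses m
  -- collides with the vertex of S_j in the class of v_i.
  root-above : ∀ {i j m e} → MissesOther i m → ¬ Covers j m →
    Dist (root i) m (suc e) → Dist (root j) m e → ⊥
  root-above {i} {j} {m} (uncov , fi≢m) uncov-j di dj
    with covered-except uncov-j fi≢m
  ... | y , y∈S , fy = separates (λ ()) (sym fy) equal
    where
    equal : ∀ q → f (root i) ≢ q → ¬ ¬ ∃ λ d → Dist (root i) q d × Dist (leaf j y) q d
    equal q fi≢q k with q ≟ m
    ... | yes refl = k (_ , di , leaf-dist-uncovered y∈S uncov-j dj)
    ... | no q≢m = k (1 , root-dist-covered (covered-except uncov q≢m) fi≢q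
                        , leaf-dist-covered y∈S (covered-except uncov-j q≢m) (fi≢q ∘ trans (sym fy)))

  -- Roots missing m at different distances: walk down from the farther one.
  unequal-distances : ∀ {i i′ m D D′} → MissesOther i m → MissesOther i′ m → D′ < D →
    Dist (root i) m D → Dist (root i′) m D′ → ⊥
  unequal-distances {D′ = zero} _ (_ , fi′≢m) _ _ di′ = fi′≢m (dist-zero di′)
  unequal-distances {D = suc zero} {suc _} _ _ (s≤s ()) _ _
  unequal-distances {D = suc (suc zero)} {suc zero} miss (uncov′ , _) _ di di′ =
    root-above miss uncov′ di di′
  unequal-distances {D = suc (suc zero)} {suc (suc _)} _ _ (s≤s (s≤s ())) _ _
  unequal-distances {D = suc (suc (suc e))} {suc _} miss _ _ di _ with root-descent di
  ... | a , da = root-above miss (λ cov → ℕP.<⇒≱ (s≤s (s≤s z≤n)) (root-dist-≤1 cov da)) di da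

  same-missing-class : ∀ {i i′ m} → i ≢ i′ → MissesOther i m → MissesOther i′ m → ⊥
  same-missing-class {i} {i′} {m} i≢i′ miss miss′ =
    root-dist i m λ (D , di) → root-dist i′ m λ (D′ , di′) → compare di di′
    where
    compare : ∀ {D D′} → Dist (root i) m D → Dist (root i′) m D′ → ⊥
    compare {D} {D′} di di′ with ℕP.<-cmp D D′
    ... | tri< D<D′ _ _ = unequal-distances miss′ miss D<D′ di′ di
    ... | tri≈ _ refl _ = equidistant-roots i≢i′ miss miss′ di di′
    ... | tri> _ _ D′<D = unequal-distances miss miss′ D′<D di di′

  same-label : ∀ {i i′} → i ≢ i′ → (k : Kind i) (k′ : Kind i′) → label k ≡ label k′ → ⊥
  same-label i≢i′ (inj₁ sat) (inj₁ sat′) _ = two-saturated i≢i′ sat sat′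
  same-label _ (inj₁ _) (inj₂ _) eq = FinP.fromℕ≢inject₁ eq
  same-label _ (inj₂ _) (inj₁ _) eq = FinP.fromℕ≢inject₁ (sym eq)
  same-label i≢i′ (inj₂ (_ , miss)) (inj₂ (_ , miss′)) eq with FinP.inject₁-injective eq
  ... | refl = same-missing-class i≢i′ miss miss′

  contradiction : ⊥
  contradiction with FinP.pigeonhole many-roots (label ∘ classify)
  ... | i , i′ , i<i′ , eq = same-label (FinP.<⇒≢ i<i′) (classify i) (classify i′) eq

at-least-two : ∀ c → 5 ≤ 2 * c + 1 → 2 ≤ c
at-least-two zero (s≤s ())
at-least-two (suc zero) (s≤s (s≤s (s≤s ())))
at-least-two (suc (suc c)) _ = s≤s (s≤s z≤n)

more-roots-than-labels : ∀ {c p n} → 2 ≤ c → p < c + 2 → 2 * c + 1 < n → suc p < n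
more-roots-than-labels {c} {p} {n} 2≤c p<c+2 2c+1<n = begin-strict
  suc p           ≤⟨ p<c+2 ⟩
  c + 2           ≤⟨ ℕP.+-monoʳ-≤ c (ℕP.m≤n⇒m≤n+o 1 2≤c) ⟩
  c + (c + 1)     ≡⟨ ℕP.+-assoc c c 1 ⟨
  c + c + 1       ≡⟨ cong (λ z → c + z + 1) (ℕP.+-identityʳ c) ⟨
  2 * c + 1       <⟨ 2c+1<n ⟩
  n               ∎
  where open ℕP.≤-Reasoning

theorem11 : (n m : ℕ) (G : Graph (Fin n)) → Connected G →
    (H : Graph (Fin m)) (c : ℕ) → IsC H c →
    2 * c + 1 < n → 5 ≤ 2 * c + 1 →
    (p : ℕ) → IsPartitionDimension (corona G H) p → c + 2 ≤ p
theorem11 n m G connected H c ((S , (_ , complete , closed) , refl) , _) 2c+1<n 5≤2c+1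
          p ((f , partition , resolving) , _) =
  ℕP.≮⇒≥ λ p<c+2 →
    LowerBound.contradiction G connected H S complete closed f partition resolving
      p<c+2 S-large (more-roots-than-labels S-large p<c+2 2c+1<n)
  where
  S-large : 2 ≤ ∣ S ∣
  S-large = at-least-two ∣ S ∣ 5≤2c+1
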